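{- Let $k\geq 3$, let $K=N(k)$ and let $(K,\circ)$ be any idempotent quasigroup of order $k$. Then the array $U_k$ of order $k+2$ defined below is a non-separable $k$-latin square: $U_k(i,i)=\{i,(k+1)^{k-1}\}$ for $i\in K$; $U_k(i\odot 1,i)=\{k+1,((i\odot 1)\circ i)^{k-1}\}$ for $i\in K$; $U_k(i,j)=\{k+2,(i\circ j)^{k-1}\}$ for $i,j\in K$ with $i\neq j$ and $i\neq j\odot 1$; $U_k(i,k+1)=U_k(k+1,i)=\{i^{k-1},k+2\}$ for $i\in K$; $U_k(i,k+2)=U_k(k+2,i)=\{k+2\}\cup (K\setminus\{i\})$ for $i\in K$; $U_k(k+1,k+1)=U_k(k+2,k+2)=K$; $U_k(k+1,k+2)=U_k(k+2,k+1)=(k+1)^k$.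
   Context: For a positive integer $a$, $N(a)=\{1,\dots,a\}$, and for an integer $x$, $(x \bmod a)$ denotes the unique element of $N(a)$ congruent to $x$ modulo $a$. For $a,b\in K=N(k)$, $a\odot b=(a+b \bmod k)$. In a multiset, $x^y$ means $y$ copies of $x$. An idempotent quasigroup is a quasigroup with $a\circ a=a$ for all $a$. A $k$-latin square of order $n$ is an $n\times n$ array $L$ whose cell $(i,j)$ contains a multiset $L(i,j)$ of exactly $k$ elements of $N(n)$, such that each symbol occurs exactly $k$ times (counting multiplicity) in each row and in each column. The join of a $k_1$-latin square and a $k_2$-latin square of the same order is the $(k_1+k_2)$-latin square with cellwise multiset unions. A $k$-latin square is separable if for some positive $k_1,k_2<k$ with $k_1+k_2=k$ it is the join of a $k_1$-latin square and a $k_2$-latin square; otherwise non-separable. -}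

module Defs where

open import Data.Nat using (ℕ; zero; suc; _+_; _∸_; _≤_; NonZero)
open import Data.Nat.DivMod using (_mod_)
open import Data.Fin using (Fin; zero; suc; toℕ; splitAt; _↑ˡ_; _↑ʳ_; _≟_)
open import Data.List using (List; []; _∷_; _++_; length; filter; replicate; map; tabulate; allFin)
open import Data.List.Relation.Binary.Permutation.Propositional using (_↭_)
open import Data.Product using (Σ; ∃; ∃-syntax; _×_; _,_)
open import Data.Sum using (inj₁; inj₂)
open import Relation.Nullary using (¬_; ¬?; yes; no)
open import Algebra.Core using (Op₂)
open import Data.Nat.ListAction using (sum)
open import Relation.Binary.PropositionalEquality using (_≡_)

-- Symbols/indices of N(n) = {1,…,n} are represented by Fin n,
-- where x : Fin n stands for the integer toℕ x + 1.
-- A multiset of elements of N(n) is represented by a List (Fin n), taken up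
-- to permutation (_↭_); the multiplicity of s in xs is  mult s xs.

mult : ∀ {n} → Fin n → List (Fin n) → ℕ
mult s xs = length (filter (s ≟_) xs)

Σ[_] : ∀ n → (Fin n → ℕ) → ℕ
Σ[ n ] f = sum (tabulate {n = n} f)

IsKLatin : (n k : ℕ) → (Fin n → Fin n → List (Fin n)) → Set
IsKLatin n k L =
    (∀ i j → length (L i j) ≡ k)
  × (∀ i s → Σ[ n ] (λ j → mult s (L i j)) ≡ k)
  × (∀ j s → Σ[ n ] (λ i → mult s (L i j)) ≡ k)

Separable : (n k : ℕ) → (Fin n → Fin n → List (Fin n)) → Set
Separable n k L =
  Σ ℕ λ k₁ → Σ ℕ λ k₂ →
    1 ≤ k₁ × 1 ≤ k₂ × k₁ + k₂ ≡ k ×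
    Σ (Fin n → Fin n → List (Fin n)) λ A →
    Σ (Fin n → Fin n → List (Fin n)) λ B →
      IsKLatin n k₁ A × IsKLatin n k₂ B × (∀ i j → L i j ↭ (A i j ++ B i j))

NonSeparable : (n k : ℕ) → (Fin n → Fin n → List (Fin n)) → Set
NonSeparable n k L = ¬ Separable n k L

-- a ⊙ b = (a + b mod k) on K = N(k).  In 0-based terms (labels a+1, b+1):
-- the 0-based representative of the result is (a + b + 1) mod k.
_⊙_ : ∀ {k} → Fin k → Fin k → Fin k
_⊙_ {suc m} a b = (toℕ a + toℕ b + 1) mod (suc m)

-- i ⊙ 1  (the element 1 ∈ K is the 0-based zero)
_⊙1 : ∀ {k} → Fin k → Fin k
_⊙1 {suc m} i = i ⊙ zero

-- The array U_k of order k+2.  Index/symbol a : Fin k (↦ a ↑ˡ 2) stands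
-- for a ∈ K; k ↑ʳ zero stands for k+1; k ↑ʳ suc zero stands for k+2.
module _ (k : ℕ) (_∘_ : Op₂ (Fin k)) where

  emb : Fin k → Fin (k + 2)
  emb a = a ↑ˡ 2

  sA : Fin (k + 2)
  sA = k ↑ʳ zero

  sB : Fin (k + 2)
  sB = k ↑ʳ suc zero

  Kall : List (Fin (k + 2))
  Kall = map emb (allFin k)

  Kminus : Fin k → List (Fin (k + 2))
  Kminus a = map emb (filter (λ x → ¬? (a ≟ x)) (allFin k))

  Ucell : Fin k → Fin k → List (Fin (k + 2))
  Ucell a b with a ≟ b
  ... | yes _ = emb a ∷ replicate (k ∸ 1) sA
  ... | no _ with a ≟ (b ⊙1)
  ...   | yes _ = sA ∷ replicate (k ∸ 1) (emb (a ∘ b))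
  ...   | no _  = sB ∷ replicate (k ∸ 1) (emb (a ∘ b))

  U : Fin (k + 2) → Fin (k + 2) → List (Fin (k + 2))
  U i j with splitAt k i | splitAt k j
  ... | inj₁ a             | inj₁ b             = Ucell a b
  ... | inj₁ a             | inj₂ zero          = replicate (k ∸ 1) (emb a) ++ (sB ∷ [])
  ... | inj₂ zero          | inj₁ a             = replicate (k ∸ 1) (emb a) ++ (sB ∷ [])
  ... | inj₁ a             | inj₂ (suc zero)    = sB ∷ Kminus a
  ... | inj₂ (suc zero)    | inj₁ a             = sB ∷ Kminus a
  ... | inj₂ zero          | inj₂ zero          = Kall
  ... | inj₂ (suc zero)    | inj₂ (suc zero)    = Kall
  ... | inj₂ zero          | inj₂ (suc zero)    = replicate k sA
  ... | inj₂ (suc zero)    | inj₂ zero          = replicate k sA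

module Submission where

-- Every inner cell of U_k is one "lead" symbol plus k-1
-- copies of a "bulk" symbol.  A row or a column of the inner block follows a
-- common LinePattern: the lead symbols are c, k+1 and otherwise k+2, and the
-- bulk symbols are k+1 and the values of a permutation of K (a ∘ _ for rows,
-- _ ∘ b for columns, by the quasigroup divisions).
--
-- If C ⊑ U_k is a k'-latin square, counting k+1, a and k+2
-- in lines and cells of C where they have only two admissible places shows
-- that the number of copies of k+1 in C(a ⊙ 1, a) is constant along the cycle
-- generated by ⊙ 1 and that k of them sum to k'.  So for k' ≥ 1 the cell
-- C(1 ⊙ 1, 1) contains k+1; but U_k(1 ⊙ 1, 1) contains it only once, so it
-- cannot be split between the two parts of a join.

open import Defs
open import Data.Nat using (ℕ; zero; suc; _+_; _*_; _≤_; z≤n; s≤s; _%_)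
open import Data.Nat.DivMod using (%-congˡ; m<n⇒m%n≡m; n%n≡0)
open import Data.Nat.Properties
  using (+-assoc; +-comm; +-identityʳ; *-zeroʳ; *-identityʳ; *-distribˡ-+; +-commutativeSemigroup;
         <⇒≢; 1+n≢n; m≤m+n; m≤n+m; n≤0⇒n≡0; +-cancelˡ-≡; +-cancelʳ-≡; +-mono-≤; <⇒≱)
open import Algebra.Properties.CommutativeSemigroup +-commutativeSemigroup using (interchange)
open import Data.Fin using (Fin; zero; suc; toℕ; fromℕ; inject₁; _↑ˡ_; _↑ʳ_; _≟_; splitAt)
open import Data.Fin.Properties
  using (suc-injective; toℕ-injective; toℕ-fromℕ<; toℕ-fromℕ; toℕ-inject₁; toℕ<n;
         ↑ˡ-injective; splitAt-↑ˡ; splitAt-↑ʳ; splitAt⁻¹-↑ˡ; splitAt⁻¹-↑ʳ)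
open import Data.Fin.Relation.Unary.Top using (view; ‵fromℕ; ‵inject₁)
open import Data.Fin.Induction using (<-weakInduction)
open import Data.List using (List; []; _∷_; _++_; length; filter; replicate; map; tabulate; allFin)
open import Data.List.Properties using (length-++; length-replicate; length-map; length-tabulate; filter-++)
open import Data.List.Relation.Binary.Permutation.Propositional using (_↭_)
open import Data.List.Relation.Binary.Permutation.Propositional.Properties using (filter-↭; ↭-length)
open import Relation.Nullary using (¬?; yes; no)
open import Relation.Binary.PropositionalEquality
open import Data.Empty using (⊥-elim)
open import Data.Sum using (inj₁; inj₂)
open import Data.Product using (_,_; _×_; proj₁; proj₂)
open import Algebra.Core using (Op₂)
open import Algebra.Structures using (IsQuasigroup)

δ : ∀ {n} → Fin n → Fin n → ℕ
δ s t with s ≟ t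
... | yes _ = 1
... | no _  = 0

δ-≡ : ∀ {n} {s t : Fin n} → s ≡ t → δ s t ≡ 1
δ-≡ {s = s} {t} s≡t with s ≟ t
... | yes _  = refl
... | no s≢t = ⊥-elim (s≢t s≡t)

δ-≢ : ∀ {n} {s t : Fin n} → s ≢ t → δ s t ≡ 0
δ-≢ {s = s} {t} s≢t with s ≟ t
... | yes s≡t = ⊥-elim (s≢t s≡t)
... | no _    = refl

δ-comm : ∀ {n} (s t : Fin n) → δ s t ≡ δ t s
δ-comm s t with s ≟ t
... | yes s≡t = sym (δ-≡ (sym s≡t))
... | no s≢t  = sym (δ-≢ (λ t≡s → s≢t (sym t≡s)))

mult-∷ : ∀ {n} (s t : Fin n) xs → mult s (t ∷ xs) ≡ δ s t + mult s xs
mult-∷ s t xs with s ≟ t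
... | yes _ = refl
... | no _  = refl

mult-++ : ∀ {n} (s : Fin n) xs ys → mult s (xs ++ ys) ≡ mult s xs + mult s ys
mult-++ s xs ys = trans (cong length (filter-++ (s ≟_) xs ys)) (length-++ (filter (s ≟_) xs))

mult-replicate : ∀ {n} (s t : Fin n) r → mult s (replicate r t) ≡ r * δ s t
mult-replicate s t zero    = refl
mult-replicate s t (suc r) = trans (mult-∷ s t (replicate r t)) (cong (δ s t +_) (mult-replicate s t r))

mult-shape : ∀ {n} (s h t : Fin n) r → mult s (h ∷ replicate r t) ≡ δ s h + r * δ s t
mult-shape s h t r = trans (mult-∷ s h (replicate r t)) (cong (δ s h +_) (mult-replicate s t r))

mult-↭ : ∀ {n} (s : Fin n) {xs ys} → xs ↭ ys → mult s xs ≡ mult s ys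
mult-↭ s xs↭ys = ↭-length (filter-↭ (s ≟_) xs↭ys)

mult-map-injective : ∀ {n n'} (f : Fin n → Fin n') → (∀ {x y} → f x ≡ f y → x ≡ y) →
                     ∀ x l → mult (f x) (map f l) ≡ mult x l
mult-map-injective f f-inj x [] = refl
mult-map-injective f f-inj x (y ∷ l) = begin
  mult (f x) (f y ∷ map f l)     ≡⟨ mult-∷ (f x) (f y) (map f l) ⟩
  δ (f x) (f y) + mult (f x) (map f l) ≡⟨ cong₂ _+_ (δ-image x y) (mult-map-injective f f-inj x l) ⟩
  δ x y + mult x l               ≡⟨ mult-∷ x y l ⟨
  mult x (y ∷ l)                 ∎
  where
  open ≡-Reasoning
  δ-image : ∀ x y → δ (f x) (f y) ≡ δ x y
  δ-image x y with x ≟ y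
  ... | yes x≡y = δ-≡ (cong f x≡y)
  ... | no x≢y  = δ-≢ (λ fx≡fy → x≢y (f-inj fx≡fy))

mult-map-outside : ∀ {n n'} (f : Fin n → Fin n') s → (∀ x → f x ≢ s) → ∀ l → mult s (map f l) ≡ 0
mult-map-outside f s outside [] = refl
mult-map-outside f s outside (y ∷ l) =
  trans (mult-∷ s (f y) (map f l))
        (cong₂ _+_ (δ-≢ (λ s≡fy → outside y (sym s≡fy))) (mult-map-outside f s outside l))

remove : ∀ {n} → Fin n → List (Fin n) → List (Fin n)
remove a = filter (λ y → ¬? (a ≟ y))

mult-remove-≡ : ∀ {n} {a x : Fin n} → x ≡ a → ∀ l → mult x (remove a l) ≡ 0
mult-remove-≡ x≡a [] = refl
mult-remove-≡ {a = a} {x} x≡a (y ∷ l) with a ≟ y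
... | yes _   = mult-remove-≡ x≡a l
... | no a≢y  = trans (mult-∷ x y (remove a l))
                      (cong₂ _+_ (δ-≢ (λ x≡y → a≢y (trans (sym x≡a) x≡y))) (mult-remove-≡ x≡a l))

mult-remove-≢ : ∀ {n} {a x : Fin n} → x ≢ a → ∀ l → mult x (remove a l) ≡ mult x l
mult-remove-≢ x≢a [] = refl
mult-remove-≢ {a = a} {x} x≢a (y ∷ l) with a ≟ y
... | yes a≡y = trans (mult-remove-≢ x≢a l)
                      (sym (trans (mult-∷ x y l) (cong (_+ mult x l) (δ-≢ (λ x≡y → x≢a (trans x≡y (sym a≡y)))))))
... | no _    = trans (mult-∷ x y (remove a l))
                      (trans (cong (δ x y +_) (mult-remove-≢ x≢a l)) (sym (mult-∷ x y l)))

Square : ℕ → Set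
Square n = Fin n → Fin n → List (Fin n)

_⊑_ : ∀ {n} → Square n → Square n → Set
C ⊑ D = ∀ i j s → mult s (C i j) ≤ mult s (D i j)

module Join {n} {L A B : Square n} (L≡A⊔B : ∀ i j → L i j ↭ (A i j ++ B i j)) where

  mult-join : ∀ i j s → mult s (L i j) ≡ mult s (A i j) + mult s (B i j)
  mult-join i j s = trans (mult-↭ s (L≡A⊔B i j)) (mult-++ s (A i j) (B i j))

  left-⊑ : A ⊑ L
  left-⊑ i j s = subst (mult s (A i j) ≤_) (sym (mult-join i j s)) (m≤m+n _ _)

  right-⊑ : B ⊑ L
  right-⊑ i j s = subst (mult s (B i j) ≤_) (sym (mult-join i j s)) (m≤n+m _ _)

Σ-cong : ∀ n {f g : Fin n → ℕ} → (∀ i → f i ≡ g i) → Σ[ n ] f ≡ Σ[ n ] g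
Σ-cong zero    f≗g = refl
Σ-cong (suc n) f≗g = cong₂ _+_ (f≗g zero) (Σ-cong n (λ i → f≗g (suc i)))

Σ-+ : ∀ n (f g : Fin n → ℕ) → Σ[ n ] (λ i → f i + g i) ≡ Σ[ n ] f + Σ[ n ] g
Σ-+ zero    f g = refl
Σ-+ (suc n) f g = trans (cong (f zero + g zero +_) (Σ-+ n (λ i → f (suc i)) (λ i → g (suc i))))
                        (interchange (f zero) (g zero) _ _)

Σ-* : ∀ n r (f : Fin n → ℕ) → Σ[ n ] (λ i → r * f i) ≡ r * Σ[ n ] f
Σ-* zero    r f = sym (*-zeroʳ r)
Σ-* (suc n) r f = trans (cong (r * f zero +_) (Σ-* n r (λ i → f (suc i))))
                        (sym (*-distribˡ-+ r (f zero) _))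

Σ-const : ∀ n c → Σ[ n ] (λ _ → c) ≡ n * c
Σ-const zero    c = refl
Σ-const (suc n) c = cong (c +_) (Σ-const n c)

Σ-ones : ∀ n {f : Fin n → ℕ} → (∀ i → f i ≡ 1) → Σ[ n ] f ≡ n
Σ-ones n f≡1 = trans (Σ-cong n f≡1) (trans (Σ-const n 1) (*-identityʳ n))

Σ-zero : ∀ n {f : Fin n → ℕ} → (∀ i → f i ≡ 0) → Σ[ n ] f ≡ 0
Σ-zero n f≡0 = trans (Σ-cong n f≡0) (trans (Σ-const n 0) (*-zeroʳ n))

Σ-point : ∀ n {f : Fin n → ℕ} (j : Fin n) → (∀ i → i ≢ j → f i ≡ 0) → Σ[ n ] f ≡ f j
Σ-point (suc n) {f} zero    off =
  trans (cong (f zero +_) (Σ-zero n (λ i → off (suc i) (λ ())))) (+-identityʳ _)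
Σ-point (suc n) {f} (suc j) off =
  trans (cong (_+ Σ[ n ] (λ i → f (suc i))) (off zero (λ ())))
        (Σ-point n j (λ i i≢j → off (suc i) (λ si≡sj → i≢j (suc-injective si≡sj))))

Σ-two-points : ∀ n {f : Fin n → ℕ} (j₁ j₂ : Fin n) → j₁ ≢ j₂ →
               (∀ i → i ≢ j₁ → i ≢ j₂ → f i ≡ 0) → Σ[ n ] f ≡ f j₁ + f j₂
Σ-two-points (suc n) zero zero j₁≢j₂ off = ⊥-elim (j₁≢j₂ refl)
Σ-two-points (suc n) {f} zero (suc j₂) j₁≢j₂ off =
  cong (f zero +_) (Σ-point n j₂ (λ i i≢j₂ → off (suc i) (λ ()) (λ e → i≢j₂ (suc-injective e))))
Σ-two-points (suc n) {f} (suc j₁) zero j₁≢j₂ off =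
  trans (cong (f zero +_) (Σ-point n j₁ (λ i i≢j₁ → off (suc i) (λ e → i≢j₁ (suc-injective e)) (λ ()))))
        (+-comm (f zero) _)
Σ-two-points (suc n) {f} (suc j₁) (suc j₂) j₁≢j₂ off =
  trans (cong (_+ Σ[ n ] (λ i → f (suc i))) (off zero (λ ()) (λ ())))
        (Σ-two-points n j₁ j₂ (λ e → j₁≢j₂ (cong suc e))
          (λ i i≢j₁ i≢j₂ → off (suc i) (λ e → i≢j₁ (suc-injective e)) (λ e → i≢j₂ (suc-injective e))))

Σ-complement : ∀ n (f g : Fin n → ℕ) → (∀ i → f i + g i ≡ 1) → Σ[ n ] f + Σ[ n ] g ≡ n
Σ-complement n f g f+g≡1 = trans (sym (Σ-+ n f g)) (Σ-ones n f+g≡1)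

Σ-split : ∀ m n (f : Fin (m + n) → ℕ) →
          Σ[ m + n ] f ≡ Σ[ m ] (λ i → f (i ↑ˡ n)) + Σ[ n ] (λ j → f (m ↑ʳ j))
Σ-split zero    n f = refl
Σ-split (suc m) n f = trans (cong (f zero +_) (Σ-split m n (λ i → f (suc i))))
                            (sym (+-assoc (f zero) _ _))

Σ-δ : ∀ n (t : Fin n) → Σ[ n ] (λ s → δ s t) ≡ 1
Σ-δ n t = trans (Σ-point n t (λ s s≢t → δ-≢ s≢t)) (δ-≡ refl)

Σ-δ′ : ∀ n (t : Fin n) → Σ[ n ] (λ s → δ t s) ≡ 1
Σ-δ′ n t = trans (Σ-cong n (λ s → δ-comm t s)) (Σ-δ n t)

length≡Σmult : ∀ n (l : List (Fin n)) → length l ≡ Σ[ n ] (λ s → mult s l)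
length≡Σmult n []      = sym (Σ-zero n (λ _ → refl))
length≡Σmult n (t ∷ l) = sym (begin
  Σ[ n ] (λ s → mult s (t ∷ l))                 ≡⟨ Σ-cong n (λ s → mult-∷ s t l) ⟩
  Σ[ n ] (λ s → δ s t + mult s l)               ≡⟨ Σ-+ n (λ s → δ s t) (λ s → mult s l) ⟩
  Σ[ n ] (λ s → δ s t) + Σ[ n ] (λ s → mult s l) ≡⟨ cong₂ _+_ (Σ-δ n t) (sym (length≡Σmult n l)) ⟩
  suc (length l)                               ∎)
  where open ≡-Reasoning

mult-allFin : ∀ n (x : Fin n) → mult x (allFin n) ≡ 1
mult-allFin n x = trans (mult-tabulate n (λ i → i)) (Σ-δ′ n x)
  where
  mult-tabulate : ∀ r (f : Fin r → Fin n) → mult x (tabulate f) ≡ Σ[ r ] (λ i → δ x (f i))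
  mult-tabulate zero    f = refl
  mult-tabulate (suc r) f =
    trans (mult-∷ x (f zero) _) (cong (δ x (f zero) +_) (mult-tabulate r (λ i → f (suc i))))

-- In 0-based terms ⊙1 is  i ↦ i + 1 (mod k):  it moves inject₁ i to suc i
-- and wraps the top element fromℕ m around to zero.
module CyclicSuccessor (m : ℕ) where

  private
    toℕ-⊙1 : (b : Fin (suc m)) → toℕ (b ⊙1) ≡ suc (toℕ b) % suc m
    toℕ-⊙1 b = trans (toℕ-fromℕ< _) (%-congˡ (trans (cong (_+ 1) (+-identityʳ (toℕ b))) (+-comm (toℕ b) 1)))

  ⊙1-inject₁ : (i : Fin m) → inject₁ i ⊙1 ≡ suc i
  ⊙1-inject₁ i = toℕ-injective (begin
    toℕ (inject₁ i ⊙1)             ≡⟨ toℕ-⊙1 (inject₁ i) ⟩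
    suc (toℕ (inject₁ i)) % suc m  ≡⟨ cong (λ x → suc x % suc m) (toℕ-inject₁ i) ⟩
    suc (toℕ i) % suc m            ≡⟨ m<n⇒m%n≡m (s≤s (toℕ<n i)) ⟩
    suc (toℕ i)                    ∎)
    where open ≡-Reasoning

  ⊙1-fromℕ : fromℕ m ⊙1 ≡ zero
  ⊙1-fromℕ = toℕ-injective (begin
    toℕ (fromℕ m ⊙1)             ≡⟨ toℕ-⊙1 (fromℕ m) ⟩
    suc (toℕ (fromℕ m)) % suc m  ≡⟨ cong (λ x → suc x % suc m) (toℕ-fromℕ m) ⟩
    suc m % suc m                ≡⟨ n%n≡0 (suc m) ⟩
    0                            ∎)
    where open ≡-Reasoning

  _⊖1 : Fin (suc m) → Fin (suc m)
  zero  ⊖1 = fromℕ m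
  suc i ⊖1 = inject₁ i

  ⊖1-⊙1 : (a : Fin (suc m)) → (a ⊖1) ⊙1 ≡ a
  ⊖1-⊙1 zero    = ⊙1-fromℕ
  ⊖1-⊙1 (suc i) = ⊙1-inject₁ i

  ⊙1-⊖1 : (b : Fin (suc m)) → (b ⊙1) ⊖1 ≡ b
  ⊙1-⊖1 b with view b
  ... | ‵fromℕ     = cong _⊖1 ⊙1-fromℕ
  ... | ‵inject₁ i = cong _⊖1 (⊙1-inject₁ i)

  -- For k ≥ 2 the cycle has no fixed point.
  ⊙1-≢ : 1 ≤ m → (b : Fin (suc m)) → b ⊙1 ≢ b
  ⊙1-≢ 1≤m b with view b
  ... | ‵fromℕ     = λ e → <⇒≢ 1≤m (sym (trans (sym (toℕ-fromℕ m)) (cong toℕ (trans (sym e) ⊙1-fromℕ))))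
  ... | ‵inject₁ i = λ e → 1+n≢n (trans (cong toℕ (trans (sym (⊙1-inject₁ i)) e)) (toℕ-inject₁ i))

  cyclic-induction : (P : Fin (suc m) → Set) → P zero → (∀ b → P b → P (b ⊙1)) → ∀ b → P b
  cyclic-induction P P0 step =
    <-weakInduction P P0 (λ i P[i] → subst P (⊙1-inject₁ i) (step (inject₁ i) P[i]))

module Construction (m : ℕ) (1≤m : 1 ≤ m) (_∘_ _\\_ _//_ : Op₂ (Fin (suc m)))
       (isQuasigroup : IsQuasigroup _≡_ _∘_ _\\_ _//_) (idem : ∀ a → a ∘ a ≡ a) where

  open CyclicSuccessor m
  open IsQuasigroup isQuasigroup using (leftDividesˡ; leftDividesʳ; rightDividesˡ; rightDividesʳ)

  k : ℕ
  k = suc m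

  -- Points of N(k+2): E a for a ∈ K, and the two extra points ω₁ = k+1, ω₂ = k+2.
  Point : Set
  Point = Fin (k + 2)

  E : Fin k → Point
  E = emb k _∘_

  ω₁ ω₂ : Point
  ω₁ = sA k _∘_
  ω₂ = sB k _∘_

  Uₖ : Point → Point → List Point
  Uₖ = U k _∘_

  E-injective : ∀ {x y} → E x ≡ E y → x ≡ y
  E-injective {x} {y} = ↑ˡ-injective 2 x y

  E≢ω₁ : ∀ x → E x ≢ ω₁
  E≢ω₁ x e with () ← trans (sym (splitAt-↑ˡ k x 2)) (trans (cong (splitAt k) e) (splitAt-↑ʳ k 2 zero))

  E≢ω₂ : ∀ x → E x ≢ ω₂
  E≢ω₂ x e with () ← trans (sym (splitAt-↑ˡ k x 2)) (trans (cong (splitAt k) e) (splitAt-↑ʳ k 2 (suc zero)))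

  ω₁≢ω₂ : ω₁ ≢ ω₂
  ω₁≢ω₂ e with () ← trans (sym (splitAt-↑ʳ k 2 zero)) (trans (cong (splitAt k) e) (splitAt-↑ʳ k 2 (suc zero)))

  δ-E : ∀ x y → δ (E x) (E y) ≡ δ x y
  δ-E x y with x ≟ y
  ... | yes x≡y = δ-≡ (cong E x≡y)
  ... | no x≢y  = δ-≢ (λ Ex≡Ey → x≢y (E-injective Ex≡Ey))

  data PointView : Point → Set where
    ‵E  : ∀ a → PointView (E a)
    ‵ω₁ : PointView ω₁
    ‵ω₂ : PointView ω₂

  pointView : ∀ i → PointView i
  pointView i with splitAt k i in eq
  ... | inj₁ a          = subst PointView (splitAt⁻¹-↑ˡ eq) (‵E a)
  ... | inj₂ zero       = subst PointView (splitAt⁻¹-↑ʳ eq) ‵ω₁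
  ... | inj₂ (suc zero) = subst PointView (splitAt⁻¹-↑ʳ eq) ‵ω₂

  Σ-points : (f : Point → ℕ) → Σ[ k + 2 ] f ≡ Σ[ k ] (λ a → f (E a)) + (f ω₁ + (f ω₂ + 0))
  Σ-points = Σ-split k 2

  rim₁ rim₂ : Fin k → List Point
  rim₁ c = replicate m (E c) ++ (ω₂ ∷ [])
  rim₂ c = ω₂ ∷ Kminus k _∘_ c

  Kset : List Point
  Kset = Kall k _∘_

  U-E-E : ∀ a b → Uₖ (E a) (E b) ≡ Ucell k _∘_ a b
  U-E-E a b rewrite splitAt-↑ˡ k a 2 | splitAt-↑ˡ k b 2 = refl

  U-E-ω₁ : ∀ a → Uₖ (E a) ω₁ ≡ rim₁ a
  U-E-ω₁ a rewrite splitAt-↑ˡ k a 2 | splitAt-↑ʳ k 2 zero = refl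

  U-ω₁-E : ∀ a → Uₖ ω₁ (E a) ≡ rim₁ a
  U-ω₁-E a rewrite splitAt-↑ˡ k a 2 | splitAt-↑ʳ k 2 zero = refl

  U-E-ω₂ : ∀ a → Uₖ (E a) ω₂ ≡ rim₂ a
  U-E-ω₂ a rewrite splitAt-↑ˡ k a 2 | splitAt-↑ʳ k 2 (suc zero) = refl

  U-ω₂-E : ∀ a → Uₖ ω₂ (E a) ≡ rim₂ a
  U-ω₂-E a rewrite splitAt-↑ˡ k a 2 | splitAt-↑ʳ k 2 (suc zero) = refl

  U-ω₁-ω₁ : Uₖ ω₁ ω₁ ≡ Kset
  U-ω₁-ω₁ rewrite splitAt-↑ʳ k 2 zero = refl

  U-ω₂-ω₂ : Uₖ ω₂ ω₂ ≡ Kset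
  U-ω₂-ω₂ rewrite splitAt-↑ʳ k 2 (suc zero) = refl

  U-ω₁-ω₂ : Uₖ ω₁ ω₂ ≡ replicate k ω₁
  U-ω₁-ω₂ rewrite splitAt-↑ʳ k 2 zero | splitAt-↑ʳ k 2 (suc zero) = refl

  U-ω₂-ω₁ : Uₖ ω₂ ω₁ ≡ replicate k ω₁
  U-ω₂-ω₁ rewrite splitAt-↑ʳ k 2 zero | splitAt-↑ʳ k 2 (suc zero) = refl

  U-symmetric-ω₁ : ∀ i → Uₖ i ω₁ ≡ Uₖ ω₁ i
  U-symmetric-ω₁ i with pointView i
  ... | ‵E a = trans (U-E-ω₁ a) (sym (U-ω₁-E a))
  ... | ‵ω₁  = refl
  ... | ‵ω₂  = trans U-ω₂-ω₁ (sym U-ω₁-ω₂)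

  U-symmetric-ω₂ : ∀ i → Uₖ i ω₂ ≡ Uₖ ω₂ i
  U-symmetric-ω₂ i with pointView i
  ... | ‵E a = trans (U-E-ω₂ a) (sym (U-ω₂-E a))
  ... | ‵ω₁  = trans U-ω₁-ω₂ (sym U-ω₂-ω₁)
  ... | ‵ω₂  = refl

  lead : Fin k → Fin k → Point
  lead a b with a ≟ b
  ... | yes _ = E a
  ... | no _ with a ≟ (b ⊙1)
  ...   | yes _ = ω₁
  ...   | no _  = ω₂

  bulk : Fin k → Fin k → Point
  bulk a b with a ≟ b
  ... | yes _ = ω₁
  ... | no _  = E (a ∘ b)

  Ucell-shape : ∀ a b → Ucell k _∘_ a b ≡ lead a b ∷ replicate m (bulk a b)
  Ucell-shape a b with a ≟ b
  ... | yes _ = refl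
  ... | no _ with a ≟ (b ⊙1)
  ...   | yes _ = refl
  ...   | no _  = refl

  lead-diag : ∀ {a b} → a ≡ b → lead a b ≡ E a
  lead-diag {a} {b} a≡b with a ≟ b
  ... | yes _  = refl
  ... | no a≢b = ⊥-elim (a≢b a≡b)

  lead-succ : ∀ {a b} → a ≢ b → a ≡ b ⊙1 → lead a b ≡ ω₁
  lead-succ {a} {b} a≢b a≡b⊙1 with a ≟ b
  ... | yes a≡b = ⊥-elim (a≢b a≡b)
  ... | no _ with a ≟ (b ⊙1)
  ...   | yes _      = refl
  ...   | no a≢b⊙1   = ⊥-elim (a≢b⊙1 a≡b⊙1)

  lead-other : ∀ {a b} → a ≢ b → a ≢ b ⊙1 → lead a b ≡ ω₂
  lead-other {a} {b} a≢b a≢b⊙1 with a ≟ b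
  ... | yes a≡b = ⊥-elim (a≢b a≡b)
  ... | no _ with a ≟ (b ⊙1)
  ...   | yes a≡b⊙1 = ⊥-elim (a≢b⊙1 a≡b⊙1)
  ...   | no _      = refl

  bulk-diag : ∀ {a b} → a ≡ b → bulk a b ≡ ω₁
  bulk-diag {a} {b} a≡b with a ≟ b
  ... | yes _  = refl
  ... | no a≢b = ⊥-elim (a≢b a≡b)

  bulk-off : ∀ {a b} → a ≢ b → bulk a b ≡ E (a ∘ b)
  bulk-off {a} {b} a≢b with a ≟ b
  ... | yes a≡b = ⊥-elim (a≢b a≡b)
  ... | no _    = refl

  mult-rim₁ : ∀ s c → mult s (rim₁ c) ≡ m * δ s (E c) + (δ s ω₂ + 0)
  mult-rim₁ s c = trans (mult-++ s (replicate m (E c)) (ω₂ ∷ []))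
                        (cong₂ _+_ (mult-replicate s (E c) m) (mult-∷ s ω₂ []))

  rim₁-E-≡ : ∀ {x c} → x ≡ c → mult (E x) (rim₁ c) ≡ m
  rim₁-E-≡ {x} {c} x≡c = trans (mult-rim₁ (E x) c)
    (trans (cong₂ _+_ (cong (m *_) (δ-≡ (cong E x≡c))) (cong (_+ 0) (δ-≢ (E≢ω₂ x))))
           (trans (+-identityʳ _) (*-identityʳ m)))

  rim₁-E-≢ : ∀ {x c} → x ≢ c → mult (E x) (rim₁ c) ≡ 0
  rim₁-E-≢ {x} {c} x≢c = trans (mult-rim₁ (E x) c)
    (cong₂ _+_ (trans (cong (m *_) (δ-≢ (λ e → x≢c (E-injective e)))) (*-zeroʳ m)) (cong (_+ 0) (δ-≢ (E≢ω₂ x))))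

  rim₁-ω₁ : ∀ c → mult ω₁ (rim₁ c) ≡ 0
  rim₁-ω₁ c = trans (mult-rim₁ ω₁ c)
    (cong₂ _+_ (trans (cong (m *_) (δ-≢ (≢-sym (E≢ω₁ c)))) (*-zeroʳ m)) (cong (_+ 0) (δ-≢ ω₁≢ω₂)))

  rim₁-ω₂ : ∀ c → mult ω₂ (rim₁ c) ≡ 1
  rim₁-ω₂ c = trans (mult-rim₁ ω₂ c)
    (cong₂ _+_ (trans (cong (m *_) (δ-≢ (≢-sym (E≢ω₂ c)))) (*-zeroʳ m)) (cong (_+ 0) (δ-≡ refl)))

  mult-E-map : ∀ x l → mult (E x) (map E l) ≡ mult x l
  mult-E-map = mult-map-injective E E-injective

  mult-ω₁-map : ∀ l → mult ω₁ (map E l) ≡ 0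
  mult-ω₁-map = mult-map-outside E ω₁ E≢ω₁

  mult-ω₂-map : ∀ l → mult ω₂ (map E l) ≡ 0
  mult-ω₂-map = mult-map-outside E ω₂ E≢ω₂

  rim₂-E-≡ : ∀ {x c} → x ≡ c → mult (E x) (rim₂ c) ≡ 0
  rim₂-E-≡ {x} {c} x≡c = trans (mult-∷ (E x) ω₂ (map E (remove c (allFin k))))
    (cong₂ _+_ (δ-≢ (E≢ω₂ x)) (trans (mult-E-map x (remove c (allFin k))) (mult-remove-≡ x≡c (allFin k))))

  rim₂-E-≢ : ∀ {x c} → x ≢ c → mult (E x) (rim₂ c) ≡ 1
  rim₂-E-≢ {x} {c} x≢c = trans (mult-∷ (E x) ω₂ (map E (remove c (allFin k))))
    (cong₂ _+_ (δ-≢ (E≢ω₂ x))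
               (trans (mult-E-map x (remove c (allFin k))) (trans (mult-remove-≢ x≢c (allFin k)) (mult-allFin k x))))

  rim₂-E : ∀ x c → mult (E x) (rim₂ c) + δ x c ≡ 1
  rim₂-E x c with x ≟ c
  ... | yes x≡c = cong (_+ 1) (rim₂-E-≡ x≡c)
  ... | no x≢c  = cong (_+ 0) (rim₂-E-≢ x≢c)

  rim₂-ω₁ : ∀ c → mult ω₁ (rim₂ c) ≡ 0
  rim₂-ω₁ c = trans (mult-∷ ω₁ ω₂ _) (cong₂ _+_ (δ-≢ ω₁≢ω₂) (mult-ω₁-map (remove c (allFin k))))

  rim₂-ω₂ : ∀ c → mult ω₂ (rim₂ c) ≡ 1
  rim₂-ω₂ c = trans (mult-∷ ω₂ ω₂ _) (cong₂ _+_ (δ-≡ refl) (mult-ω₂-map (remove c (allFin k))))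

  Kset-E : ∀ x → mult (E x) Kset ≡ 1
  Kset-E x = trans (mult-E-map x (allFin k)) (mult-allFin k x)

  Kset-ω₁ : mult ω₁ Kset ≡ 0
  Kset-ω₁ = mult-ω₁-map (allFin k)

  Kset-ω₂ : mult ω₂ Kset ≡ 0
  Kset-ω₂ = mult-ω₂-map (allFin k)

  replicate-ω₁ : ∀ s → s ≢ ω₁ → mult s (replicate k ω₁) ≡ 0
  replicate-ω₁ s s≢ω₁ = trans (mult-replicate s ω₁ k) (trans (cong (k *_) (δ-≢ s≢ω₁)) (*-zeroʳ k))

  replicate-ω₁-ω₁ : mult ω₁ (replicate k ω₁) ≡ k
  replicate-ω₁-ω₁ = trans (mult-replicate ω₁ ω₁ k) (trans (cong (k *_) (δ-≡ refl)) (*-identityʳ k))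

  -- A line (row or column) of the inner k×k block through the diagonal cell
  -- of c ∈ K.
  record LinePattern (c : Fin k) : Set where
    field
      p q           : Fin k
      leadAt bulkAt : Fin k → Point
      f g           : Fin k → Fin k
      p≢q           : p ≢ q
      lead-p        : leadAt p ≡ E c
      lead-q        : leadAt q ≡ ω₁
      lead-else     : ∀ j → j ≢ p → j ≢ q → leadAt j ≡ ω₂
      bulk-p        : bulkAt p ≡ ω₁
      bulk-else     : ∀ j → j ≢ p → bulkAt j ≡ E (f j)
      f-p           : f p ≡ c
      f-g           : ∀ x → f (g x) ≡ x
      g-f           : ∀ j → g (f j) ≡ j

    cell : Fin k → List Point
    cell j = leadAt j ∷ replicate m (bulkAt j)

  module LineCounts {c : Fin k} (L : LinePattern c) where
    open LinePattern L

    f-c : ∀ {j} → f j ≡ c → j ≡ p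
    f-c {j} fj≡c = trans (sym (g-f j)) (trans (cong g (trans fj≡c (sym f-p))) (g-f p))

    lead-off-p : ∀ x j → j ≢ p → δ (E x) (leadAt j) ≡ 0
    lead-off-p x j j≢p with j ≟ q
    ... | yes j≡q = trans (cong (δ (E x)) (trans (cong leadAt j≡q) lead-q)) (δ-≢ (E≢ω₁ x))
    ... | no j≢q  = trans (cong (δ (E x)) (lead-else j j≢p j≢q)) (δ-≢ (E≢ω₂ x))

    Σ-lead-E : ∀ x → Σ[ k ] (λ j → δ (E x) (leadAt j)) ≡ δ x c
    Σ-lead-E x = trans (Σ-point k p (lead-off-p x)) (trans (cong (δ (E x)) lead-p) (δ-E x c))

    Σ-lead-ω₁ : Σ[ k ] (λ j → δ ω₁ (leadAt j)) ≡ 1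
    Σ-lead-ω₁ = trans (Σ-point k q off-q) (trans (cong (δ ω₁) lead-q) (δ-≡ refl))
      where
      off-q : ∀ j → j ≢ q → δ ω₁ (leadAt j) ≡ 0
      off-q j j≢q with j ≟ p
      ... | yes j≡p = trans (cong (δ ω₁) (trans (cong leadAt j≡p) lead-p)) (δ-≢ (≢-sym (E≢ω₁ c)))
      ... | no j≢p  = trans (cong (δ ω₁) (lead-else j j≢p j≢q)) (δ-≢ ω₁≢ω₂)

    Σ-lead-ω₂ : Σ[ k ] (λ j → δ ω₂ (leadAt j)) + 2 ≡ k
    Σ-lead-ω₂ = trans (cong (Σ[ k ] (λ j → δ ω₂ (leadAt j)) +_) (sym Σ-p-or-q))
                      (Σ-complement k (λ j → δ ω₂ (leadAt j)) (λ j → δ j p + δ j q) ω₂-or-p-or-q)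
      where
      Σ-p-or-q : Σ[ k ] (λ j → δ j p + δ j q) ≡ 2
      Σ-p-or-q = trans (Σ-+ k (λ j → δ j p) (λ j → δ j q)) (cong₂ _+_ (Σ-δ k p) (Σ-δ k q))
      ω₂-or-p-or-q : ∀ j → δ ω₂ (leadAt j) + (δ j p + δ j q) ≡ 1
      ω₂-or-p-or-q j with j ≟ p | j ≟ q
      ... | yes j≡p | yes j≡q = ⊥-elim (p≢q (trans (sym j≡p) j≡q))
      ... | yes j≡p | no j≢q  =
        cong₂ _+_ (trans (cong (δ ω₂) (trans (cong leadAt j≡p) lead-p)) (δ-≢ (≢-sym (E≢ω₂ c)))) (+-identityʳ 1)
      ... | no j≢p  | yes j≡q =
        cong (_+ 1) (trans (cong (δ ω₂) (trans (cong leadAt j≡q) lead-q)) (δ-≢ (≢-sym ω₁≢ω₂)))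
      ... | no j≢p  | no j≢q  = cong (_+ 0) (trans (cong (δ ω₂) (lead-else j j≢p j≢q)) (δ-≡ refl))

    bulk-E : ∀ x j → j ≢ p → δ (E x) (bulkAt j) ≡ δ x (f j)
    bulk-E x j j≢p = trans (cong (δ (E x)) (bulk-else j j≢p)) (δ-E x (f j))

    bulk-p-E : ∀ x → δ (E x) (bulkAt p) ≡ 0
    bulk-p-E x = trans (cong (δ (E x)) bulk-p) (δ-≢ (E≢ω₁ x))

    Σ-bulk-E-c : Σ[ k ] (λ j → δ (E c) (bulkAt j)) ≡ 0
    Σ-bulk-E-c = Σ-zero k term
      where
      term : ∀ j → δ (E c) (bulkAt j) ≡ 0
      term j with j ≟ p
      ... | yes refl = bulk-p-E c
      ... | no j≢p   = trans (bulk-E c j j≢p) (δ-≢ (λ c≡fj → j≢p (f-c (sym c≡fj))))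

    Σ-bulk-E-≢ : ∀ {x} → x ≢ c → Σ[ k ] (λ j → δ (E x) (bulkAt j)) ≡ 1
    Σ-bulk-E-≢ {x} x≢c = trans (Σ-point k (g x) off) (trans (bulk-E x (g x) gx≢p) (δ-≡ (sym (f-g x))))
      where
      gx≢p : g x ≢ p
      gx≢p gx≡p = x≢c (trans (sym (f-g x)) (trans (cong f gx≡p) f-p))
      off : ∀ j → j ≢ g x → δ (E x) (bulkAt j) ≡ 0
      off j j≢gx with j ≟ p
      ... | yes refl = bulk-p-E x
      ... | no j≢p   = trans (bulk-E x j j≢p) (δ-≢ (λ x≡fj → j≢gx (trans (sym (g-f j)) (cong g (sym x≡fj)))))

    Σ-bulk-ω₁ : Σ[ k ] (λ j → δ ω₁ (bulkAt j)) ≡ 1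
    Σ-bulk-ω₁ = trans (Σ-point k p off) (trans (cong (δ ω₁) bulk-p) (δ-≡ refl))
      where
      off : ∀ j → j ≢ p → δ ω₁ (bulkAt j) ≡ 0
      off j j≢p = trans (cong (δ ω₁) (bulk-else j j≢p)) (δ-≢ (≢-sym (E≢ω₁ (f j))))

    Σ-bulk-ω₂ : Σ[ k ] (λ j → δ ω₂ (bulkAt j)) ≡ 0
    Σ-bulk-ω₂ = Σ-zero k term
      where
      term : ∀ j → δ ω₂ (bulkAt j) ≡ 0
      term j with j ≟ p
      ... | yes refl = trans (cong (δ ω₂) bulk-p) (δ-≢ (≢-sym ω₁≢ω₂))
      ... | no j≢p   = trans (cong (δ ω₂) (bulk-else j j≢p)) (δ-≢ (≢-sym (E≢ω₂ (f j))))

    Σ-cells : ∀ s → Σ[ k ] (λ j → mult s (cell j))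
                  ≡ Σ[ k ] (λ j → δ s (leadAt j)) + m * Σ[ k ] (λ j → δ s (bulkAt j))
    Σ-cells s = begin
      Σ[ k ] (λ j → mult s (cell j))
        ≡⟨ Σ-cong k (λ j → mult-shape s (leadAt j) (bulkAt j) m) ⟩
      Σ[ k ] (λ j → δ s (leadAt j) + m * δ s (bulkAt j))
        ≡⟨ Σ-+ k (λ j → δ s (leadAt j)) (λ j → m * δ s (bulkAt j)) ⟩
      Σ[ k ] (λ j → δ s (leadAt j)) + Σ[ k ] (λ j → m * δ s (bulkAt j))
        ≡⟨ cong (Σ[ k ] (λ j → δ s (leadAt j)) +_) (Σ-* k m (λ j → δ s (bulkAt j))) ⟩
      Σ[ k ] (λ j → δ s (leadAt j)) + m * Σ[ k ] (λ j → δ s (bulkAt j)) ∎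
      where open ≡-Reasoning

    Σ-cells-E-c : Σ[ k ] (λ j → mult (E c) (cell j)) ≡ 1
    Σ-cells-E-c = trans (Σ-cells (E c))
      (cong₂ _+_ (trans (Σ-lead-E c) (δ-≡ refl)) (trans (cong (m *_) Σ-bulk-E-c) (*-zeroʳ m)))

    Σ-cells-E-≢ : ∀ {x} → x ≢ c → Σ[ k ] (λ j → mult (E x) (cell j)) ≡ m
    Σ-cells-E-≢ {x} x≢c = trans (Σ-cells (E x))
      (cong₂ _+_ (trans (Σ-lead-E x) (δ-≢ x≢c)) (trans (cong (m *_) (Σ-bulk-E-≢ x≢c)) (*-identityʳ m)))

    Σ-cells-ω₁ : Σ[ k ] (λ j → mult ω₁ (cell j)) ≡ k
    Σ-cells-ω₁ = trans (Σ-cells ω₁)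
      (cong₂ _+_ Σ-lead-ω₁ (trans (cong (m *_) Σ-bulk-ω₁) (*-identityʳ m)))

    Σ-cells-ω₂ : Σ[ k ] (λ j → mult ω₂ (cell j)) + 2 ≡ k
    Σ-cells-ω₂ = trans (cong (_+ 2) (trans (Σ-cells ω₂)
      (trans (cong (Σ[ k ] (λ j → δ ω₂ (leadAt j)) +_) (trans (cong (m *_) Σ-bulk-ω₂) (*-zeroʳ m)))
             (+-identityʳ _)))) Σ-lead-ω₂

    line-total : ∀ s → Σ[ k ] (λ j → mult s (cell j)) + (mult s (rim₁ c) + (mult s (rim₂ c) + 0)) ≡ k
    line-total s with pointView s
    ... | ‵E x with x ≟ c
    ...   | yes refl = trans (cong₂ _+_ Σ-cells-E-c (cong₂ _+_ (rim₁-E-≡ {c} refl) (cong (_+ 0) (rim₂-E-≡ {c} refl))))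
                             (cong suc (+-identityʳ m))
    ...   | no x≢c   = trans (cong₂ _+_ (Σ-cells-E-≢ x≢c) (cong₂ _+_ (rim₁-E-≢ x≢c) (cong (_+ 0) (rim₂-E-≢ x≢c))))
                             (+-comm m 1)
    line-total s | ‵ω₁ = trans (cong₂ _+_ Σ-cells-ω₁ (cong₂ _+_ (rim₁-ω₁ c) (cong (_+ 0) (rim₂-ω₁ c))))
                             (+-identityʳ k)
    line-total s | ‵ω₂ = trans (cong (Σ[ k ] (λ j → mult ω₂ (cell j)) +_) (cong₂ _+_ (rim₁-ω₂ c) (cong (_+ 0) (rim₂-ω₂ c)))) Σ-cells-ω₂

    ω₁-off-line : ∀ j → j ≢ p → j ≢ q → mult ω₁ (cell j) ≡ 0
    ω₁-off-line j j≢p j≢q = trans (mult-shape ω₁ (leadAt j) (bulkAt j) m)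
      (cong₂ _+_ (trans (cong (δ ω₁) (lead-else j j≢p j≢q)) (δ-≢ ω₁≢ω₂))
                 (trans (cong (λ t → m * δ ω₁ t) (bulk-else j j≢p)) (trans (cong (m *_) (δ-≢ (≢-sym (E≢ω₁ (f j))))) (*-zeroʳ m))))

    E-c-off-line : ∀ j → j ≢ p → mult (E c) (cell j) ≡ 0
    E-c-off-line j j≢p = trans (mult-shape (E c) (leadAt j) (bulkAt j) m)
      (cong₂ _+_ (lead-off-p c j j≢p)
                 (trans (cong (m *_) (trans (bulk-E c j j≢p) (δ-≢ (λ c≡fj → j≢p (f-c (sym c≡fj)))))) (*-zeroʳ m)))

    diagonal-cell : ∀ s → s ≢ E c → s ≢ ω₁ → mult s (cell p) ≡ 0
    diagonal-cell s s≢Ec s≢ω₁ = trans (mult-shape s (leadAt p) (bulkAt p) m)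
      (cong₂ _+_ (trans (cong (δ s) lead-p) (δ-≢ s≢Ec))
                 (trans (cong (λ t → m * δ s t) bulk-p) (trans (cong (m *_) (δ-≢ s≢ω₁)) (*-zeroʳ m))))

    ω₁-at-q : mult ω₁ (cell q) ≡ 1
    ω₁-at-q = trans (mult-shape ω₁ (leadAt q) (bulkAt q) m)
      (cong₂ _+_ (trans (cong (δ ω₁) lead-q) (δ-≡ refl))
                 (trans (cong (λ t → m * δ ω₁ t) (bulk-else q (≢-sym p≢q)))
                        (trans (cong (m *_) (δ-≢ (≢-sym (E≢ω₁ (f q))))) (*-zeroʳ m))))

  rowPattern : ∀ a → LinePattern a
  rowPattern a = record
    { p = a ; q = a ⊖1 ; leadAt = lead a ; bulkAt = bulk a ; f = a ∘_ ; g = a \\_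
    ; p≢q       = a≢a⊖1
    ; lead-p    = lead-diag refl
    ; lead-q    = lead-succ a≢a⊖1 (sym (⊖1-⊙1 a))
    ; lead-else = λ b b≢a b≢a⊖1 →
        lead-other (≢-sym b≢a) (λ a≡b⊙1 → b≢a⊖1 (trans (sym (⊙1-⊖1 b)) (cong _⊖1 (sym a≡b⊙1))))
    ; bulk-p    = bulk-diag {a} refl
    ; bulk-else = λ b b≢a → bulk-off (≢-sym b≢a)
    ; f-p = idem a ; f-g = leftDividesˡ a ; g-f = leftDividesʳ a
    }
    where
    a≢a⊖1 : a ≢ a ⊖1
    a≢a⊖1 a≡a⊖1 = ⊙1-≢ 1≤m (a ⊖1) (trans (⊖1-⊙1 a) a≡a⊖1)

  colPattern : ∀ b → LinePattern b
  colPattern b = record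
    { p = b ; q = b ⊙1 ; leadAt = λ a → lead a b ; bulkAt = λ a → bulk a b ; f = _∘ b ; g = _// b
    ; p≢q       = ≢-sym (⊙1-≢ 1≤m b)
    ; lead-p    = lead-diag refl
    ; lead-q    = lead-succ (⊙1-≢ 1≤m b) refl
    ; lead-else = λ a a≢b a≢b⊙1 → lead-other a≢b a≢b⊙1
    ; bulk-p    = bulk-diag {b} refl
    ; bulk-else = λ a a≢b → bulk-off a≢b
    ; f-p = idem b ; f-g = rightDividesˡ b ; g-f = rightDividesʳ b
    }

  module Row a = LineCounts (rowPattern a)
  module Col b = LineCounts (colPattern b)

  row-cell : ∀ a b → Uₖ (E a) (E b) ≡ LinePattern.cell (rowPattern a) b
  row-cell a b = trans (U-E-E a b) (Ucell-shape a b)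

  col-cell : ∀ a b → Uₖ (E a) (E b) ≡ LinePattern.cell (colPattern b) a
  col-cell a b = trans (U-E-E a b) (Ucell-shape a b)

  length-rim₁ : ∀ c → length (rim₁ c) ≡ k
  length-rim₁ c = trans (length-++ (replicate m (E c))) (trans (cong (_+ 1) (length-replicate m)) (+-comm m 1))

  length-rim₂ : ∀ c → length (rim₂ c) ≡ k
  length-rim₂ c = begin
    length (rim₂ c)                                                     ≡⟨ length≡Σmult (k + 2) (rim₂ c) ⟩
    Σ[ k + 2 ] (λ s → mult s (rim₂ c))                                  ≡⟨ Σ-points (λ s → mult s (rim₂ c)) ⟩
    Σ[ k ] K-part + (mult ω₁ (rim₂ c) + (mult ω₂ (rim₂ c) + 0))         ≡⟨ cong (Σ[ k ] K-part +_) rims ⟩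
    Σ[ k ] K-part + Σ[ k ] (λ x → δ x c)                                ≡⟨ Σ-complement k K-part (λ x → δ x c) (λ x → rim₂-E x c) ⟩
    k                                                                   ∎
    where
    open ≡-Reasoning
    K-part : Fin k → ℕ
    K-part x = mult (E x) (rim₂ c)
    rims : mult ω₁ (rim₂ c) + (mult ω₂ (rim₂ c) + 0) ≡ Σ[ k ] (λ x → δ x c)
    rims = trans (cong₂ _+_ (rim₂-ω₁ c) (cong (_+ 0) (rim₂-ω₂ c))) (sym (Σ-δ k c))

  length-Kset : length Kset ≡ k
  length-Kset = trans (length-map E (allFin k)) (length-tabulate (λ x → x))

  cell-length : ∀ i j → length (Uₖ i j) ≡ k
  cell-length i j with pointView i | pointView j
  ... | ‵E a | ‵E b = trans (cong length (row-cell a b)) (cong suc (length-replicate m))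
  ... | ‵E a | ‵ω₁  = trans (cong length (U-E-ω₁ a)) (length-rim₁ a)
  ... | ‵E a | ‵ω₂  = trans (cong length (U-E-ω₂ a)) (length-rim₂ a)
  ... | ‵ω₁  | ‵E b = trans (cong length (U-ω₁-E b)) (length-rim₁ b)
  ... | ‵ω₁  | ‵ω₁  = trans (cong length U-ω₁-ω₁) length-Kset
  ... | ‵ω₁  | ‵ω₂  = trans (cong length U-ω₁-ω₂) (length-replicate k)
  ... | ‵ω₂  | ‵E b = trans (cong length (U-ω₂-E b)) (length-rim₂ b)
  ... | ‵ω₂  | ‵ω₁  = trans (cong length U-ω₂-ω₁) (length-replicate k)
  ... | ‵ω₂  | ‵ω₂  = trans (cong length U-ω₂-ω₂) length-Kset

  row-E : ∀ a s → Σ[ k + 2 ] (λ j → mult s (Uₖ (E a) j)) ≡ k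
  row-E a s = begin
    Σ[ k + 2 ] (λ j → mult s (Uₖ (E a) j))
      ≡⟨ Σ-points (λ j → mult s (Uₖ (E a) j)) ⟩
    Σ[ k ] (λ b → mult s (Uₖ (E a) (E b))) + (mult s (Uₖ (E a) ω₁) + (mult s (Uₖ (E a) ω₂) + 0))
      ≡⟨ cong₂ _+_ (Σ-cong k (λ b → cong (mult s) (row-cell a b)))
                   (cong₂ _+_ (cong (mult s) (U-E-ω₁ a)) (cong (λ l → mult s l + 0) (U-E-ω₂ a))) ⟩
    Σ[ k ] (λ b → mult s (LinePattern.cell (rowPattern a) b)) + (mult s (rim₁ a) + (mult s (rim₂ a) + 0))
      ≡⟨ Row.line-total a s ⟩
    k ∎
    where open ≡-Reasoning

  col-E : ∀ b s → Σ[ k + 2 ] (λ i → mult s (Uₖ i (E b))) ≡ k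
  col-E b s = begin
    Σ[ k + 2 ] (λ i → mult s (Uₖ i (E b)))
      ≡⟨ Σ-points (λ i → mult s (Uₖ i (E b))) ⟩
    Σ[ k ] (λ a → mult s (Uₖ (E a) (E b))) + (mult s (Uₖ ω₁ (E b)) + (mult s (Uₖ ω₂ (E b)) + 0))
      ≡⟨ cong₂ _+_ (Σ-cong k (λ a → cong (mult s) (col-cell a b)))
                   (cong₂ _+_ (cong (mult s) (U-ω₁-E b)) (cong (λ l → mult s l + 0) (U-ω₂-E b))) ⟩
    Σ[ k ] (λ a → mult s (LinePattern.cell (colPattern b) a)) + (mult s (rim₁ b) + (mult s (rim₂ b) + 0))
      ≡⟨ Col.line-total b s ⟩
    k ∎
    where open ≡-Reasoning

  row-ω₁ : ∀ s → Σ[ k + 2 ] (λ j → mult s (Uₖ ω₁ j)) ≡ k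
  row-ω₁ s = trans (Σ-points (λ j → mult s (Uₖ ω₁ j)))
    (trans (cong₂ _+_ (Σ-cong k (λ b → cong (mult s) (U-ω₁-E b)))
                      (cong₂ _+_ (cong (mult s) U-ω₁-ω₁) (cong (λ l → mult s l + 0) U-ω₁-ω₂)))
           (count (pointView s)))
    where
    count : ∀ {s} → PointView s → Σ[ k ] (λ b → mult s (rim₁ b)) + (mult s Kset + (mult s (replicate k ω₁) + 0)) ≡ k
    count (‵E x) = trans (cong₂ _+_ (trans (Σ-point k x (λ b b≢x → rim₁-E-≢ (≢-sym b≢x))) (rim₁-E-≡ {x} refl))
                                    (cong₂ _+_ (Kset-E x) (cong (_+ 0) (replicate-ω₁ (E x) (E≢ω₁ x)))))
                         (+-comm m 1)
    count ‵ω₁ = trans (cong₂ _+_ (Σ-zero k rim₁-ω₁) (cong₂ _+_ Kset-ω₁ (cong (_+ 0) replicate-ω₁-ω₁))) (+-identityʳ k)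
    count ‵ω₂ = trans (cong₂ _+_ (Σ-ones k rim₁-ω₂) (cong₂ _+_ Kset-ω₂ (cong (_+ 0) (replicate-ω₁ ω₂ (≢-sym ω₁≢ω₂)))))
                      (+-identityʳ k)

  row-ω₂ : ∀ s → Σ[ k + 2 ] (λ j → mult s (Uₖ ω₂ j)) ≡ k
  row-ω₂ s = trans (Σ-points (λ j → mult s (Uₖ ω₂ j)))
    (trans (cong₂ _+_ (Σ-cong k (λ b → cong (mult s) (U-ω₂-E b)))
                      (cong₂ _+_ (cong (mult s) U-ω₂-ω₁) (cong (λ l → mult s l + 0) U-ω₂-ω₂)))
           (count (pointView s)))
    where
    count : ∀ {s} → PointView s → Σ[ k ] (λ b → mult s (rim₂ b)) + (mult s (replicate k ω₁) + (mult s Kset + 0)) ≡ k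
    count (‵E x) = trans (cong (Σ[ k ] (λ b → mult (E x) (rim₂ b)) +_) (trans (cong₂ _+_ (replicate-ω₁ (E x) (E≢ω₁ x)) (cong (_+ 0) (Kset-E x)))
                                                (sym (Σ-δ′ k x))))
                         (Σ-complement k (λ b → mult (E x) (rim₂ b)) (δ x) (rim₂-E x))
    count ‵ω₁ = trans (cong₂ _+_ (Σ-zero k rim₂-ω₁) (cong₂ _+_ replicate-ω₁-ω₁ (cong (_+ 0) Kset-ω₁)))
                      (+-identityʳ k)
    count ‵ω₂ = trans (cong₂ _+_ (Σ-ones k rim₂-ω₂) (cong₂ _+_ (replicate-ω₁ ω₂ (≢-sym ω₁≢ω₂)) (cong (_+ 0) Kset-ω₂)))
                      (+-identityʳ k)

  latin : IsKLatin (k + 2) k Uₖ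
  latin = cell-length , rows , cols
    where
    rows : ∀ i s → Σ[ k + 2 ] (λ j → mult s (Uₖ i j)) ≡ k
    rows i s with pointView i
    ... | ‵E a = row-E a s
    ... | ‵ω₁  = row-ω₁ s
    ... | ‵ω₂  = row-ω₂ s
    cols : ∀ j s → Σ[ k + 2 ] (λ i → mult s (Uₖ i j)) ≡ k
    cols j s with pointView j
    ... | ‵E b = col-E b s
    ... | ‵ω₁  = trans (Σ-cong (k + 2) (λ i → cong (mult s) (U-symmetric-ω₁ i))) (row-ω₁ s)
    ... | ‵ω₂  = trans (Σ-cong (k + 2) (λ i → cong (mult s) (U-symmetric-ω₂ i))) (row-ω₂ s)

  module Subsquare (k' : ℕ) (C : Square (k + 2)) (C-latin : IsKLatin (k + 2) k' C) (C⊑U : C ⊑ Uₖ) where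

    C-length : ∀ i j → length (C i j) ≡ k'
    C-length = proj₁ C-latin

    C-rows : ∀ i s → Σ[ k + 2 ] (λ j → mult s (C i j)) ≡ k'
    C-rows = proj₁ (proj₂ C-latin)

    C-cols : ∀ j s → Σ[ k + 2 ] (λ i → mult s (C i j)) ≡ k'
    C-cols = proj₂ (proj₂ C-latin)

    vanish : ∀ {i j s} → mult s (Uₖ i j) ≡ 0 → mult s (C i j) ≡ 0
    vanish {i} {j} {s} U≡0 = n≤0⇒n≡0 (subst (mult s (C i j) ≤_) U≡0 (C⊑U i j s))

    two-places : (f : Point → ℕ) (t₁ t₂ : Point) → t₁ ≢ t₂ → (∀ i → i ≢ t₁ → i ≢ t₂ → f i ≡ 0) →
                 Σ[ k + 2 ] f ≡ k' → f t₁ + f t₂ ≡ k'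
    two-places f t₁ t₂ t₁≢t₂ off Σ≡k' = trans (sym (Σ-two-points (k + 2) t₁ t₂ t₁≢t₂ off)) Σ≡k'

    α β γ η ε : Fin k → ℕ
    α a = mult ω₁ (C (E a) (E a))
    β a = mult ω₁ (C (E (a ⊙1)) (E a))
    γ a = mult (E a) (C (E a) (E a))
    η a = mult (E a) (C (E a) ω₁)
    ε a = mult ω₂ (C (E a) ω₁)

    E≢E⊙1 : ∀ a → E a ≢ E (a ⊙1)
    E≢E⊙1 a e = ⊙1-≢ 1≤m a (sym (E-injective e))

    -- column a, symbol ω₁: only the cells (a, a) and (a ⊙ 1, a)
    ω₁-in-column : ∀ a → α a + β a ≡ k'
    ω₁-in-column a = two-places (λ i → mult ω₁ (C i (E a))) (E a) (E (a ⊙1)) (E≢E⊙1 a)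
                             (λ i → off (pointView i)) (C-cols (E a) ω₁)
      where
      off : ∀ {i} → PointView i → i ≢ E a → i ≢ E (a ⊙1) → mult ω₁ (C i (E a)) ≡ 0
      off (‵E c) c≢a c≢a⊙1 = vanish (trans (cong (mult ω₁) (col-cell c a))
                               (Col.ω₁-off-line a c (λ e → c≢a (cong E e)) (λ e → c≢a⊙1 (cong E e))))
      off ‵ω₁ _ _ = vanish (trans (cong (mult ω₁) (U-ω₁-E a)) (rim₁-ω₁ a))
      off ‵ω₂ _ _ = vanish (trans (cong (mult ω₁) (U-ω₂-E a)) (rim₂-ω₁ a))

    -- row a ⊙ 1, symbol ω₁: only the cells (a ⊙ 1, a ⊙ 1) and (a ⊙ 1, a)
    ω₁-in-row : ∀ a → α (a ⊙1) + β a ≡ k'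
    ω₁-in-row a = two-places (λ j → mult ω₁ (C (E (a ⊙1)) j)) (E (a ⊙1)) (E a) (≢-sym (E≢E⊙1 a))
                          (λ j → off (pointView j)) (C-rows (E (a ⊙1)) ω₁)
      where
      off : ∀ {j} → PointView j → j ≢ E (a ⊙1) → j ≢ E a → mult ω₁ (C (E (a ⊙1)) j) ≡ 0
      off (‵E b) b≢a⊙1 b≢a = vanish (trans (cong (mult ω₁) (row-cell (a ⊙1) b))
                               (Row.ω₁-off-line (a ⊙1) b (λ e → b≢a⊙1 (cong E e))
                                                         (λ e → b≢a (cong E (trans e (⊙1-⊖1 a))))))
      off ‵ω₁ _ _ = vanish (trans (cong (mult ω₁) (U-E-ω₁ (a ⊙1))) (rim₁-ω₁ (a ⊙1)))
      off ‵ω₂ _ _ = vanish (trans (cong (mult ω₁) (U-E-ω₂ (a ⊙1))) (rim₂-ω₁ (a ⊙1)))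

    -- the diagonal-size cell (a, a) contains only a and ω₁
    diagonal-size : ∀ a → γ a + α a ≡ k'
    diagonal-size a = two-places (λ s → mult s (C (E a) (E a))) (E a) ω₁ (E≢ω₁ a)
                            (λ s s≢Ea s≢ω₁ → vanish (trans (cong (mult s) (row-cell a a)) (Row.diagonal-cell a s s≢Ea s≢ω₁)))
                            (trans (sym (length≡Σmult (k + 2) (C (E a) (E a)))) (C-length (E a) (E a)))

    -- row a, symbol a: only the cells (a, a) and (a, k+1)
    a-in-row : ∀ a → γ a + η a ≡ k'
    a-in-row a = two-places (λ j → mult (E a) (C (E a) j)) (E a) ω₁ (E≢ω₁ a)
                         (λ j → off (pointView j)) (C-rows (E a) (E a))
      where
      off : ∀ {j} → PointView j → j ≢ E a → j ≢ ω₁ → mult (E a) (C (E a) j) ≡ 0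
      off (‵E b) b≢a _ = vanish (trans (cong (mult (E a)) (row-cell a b))
                                       (Row.E-c-off-line a b (λ e → b≢a (cong E e))))
      off ‵ω₁ _ ω₁≢ω₁ = ⊥-elim (ω₁≢ω₁ refl)
      off ‵ω₂ _ _ = vanish (trans (cong (mult (E a)) (U-E-ω₂ a)) (rim₂-E-≡ {a} refl))

    -- the cell (a, k+1) = {a^(k-1), ω₂} contains only a and ω₂
    rim-size : ∀ a → η a + ε a ≡ k'
    rim-size a = two-places (λ s → mult s (C (E a) ω₁)) (E a) ω₂ (E≢ω₂ a)
                            (λ s → off (pointView s))
                            (trans (sym (length≡Σmult (k + 2) (C (E a) ω₁))) (C-length (E a) ω₁))
      where
      off : ∀ {s} → PointView s → s ≢ E a → s ≢ ω₂ → mult s (C (E a) ω₁) ≡ 0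
      off (‵E x) x≢a _ = vanish (trans (cong (mult (E x)) (U-E-ω₁ a)) (rim₁-E-≢ (λ e → x≢a (cong E e))))
      off ‵ω₁ _ _ = vanish (trans (cong (mult ω₁) (U-E-ω₁ a)) (rim₁-ω₁ a))
      off ‵ω₂ _ ω₂≢ω₂ = ⊥-elim (ω₂≢ω₂ refl)

    -- column k+1, symbol ω₂: only the inner rows
    ω₂-in-column : Σ[ k ] ε ≡ k'
    ω₂-in-column = begin
      Σ[ k ] ε                                                          ≡⟨ +-identityʳ _ ⟨
      Σ[ k ] ε + 0                                                      ≡⟨ cong (Σ[ k ] ε +_) rims ⟨
      Σ[ k ] ε + (mult ω₂ (C ω₁ ω₁) + (mult ω₂ (C ω₂ ω₁) + 0))          ≡⟨ Σ-points (λ i → mult ω₂ (C i ω₁)) ⟨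
      Σ[ k + 2 ] (λ i → mult ω₂ (C i ω₁))                               ≡⟨ C-cols ω₁ ω₂ ⟩
      k'                                                                ∎
      where
      open ≡-Reasoning
      rims : mult ω₂ (C ω₁ ω₁) + (mult ω₂ (C ω₂ ω₁) + 0) ≡ 0
      rims = cong₂ _+_ (vanish (trans (cong (mult ω₂) U-ω₁-ω₁) Kset-ω₂))
                       (cong (_+ 0) (vanish (trans (cong (mult ω₂) U-ω₂-ω₁) (replicate-ω₁ ω₂ (≢-sym ω₁≢ω₂)))))

    β≡ε : ∀ a → β a ≡ ε a
    β≡ε a = trans (+-cancelˡ-≡ (α a) (β a) (γ a) (trans (ω₁-in-column a) (sym (trans (+-comm (α a) (γ a)) (diagonal-size a)))))
                  (+-cancelˡ-≡ (η a) (γ a) (ε a) (trans (+-comm (η a) (γ a)) (trans (a-in-row a) (sym (rim-size a)))))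

    -- α is invariant under a ↦ a ⊙ 1, hence constant along the cycle; so is β.
    α-constant : ∀ a → α a ≡ α zero
    α-constant = cyclic-induction (λ a → α a ≡ α zero) refl
      (λ a αa≡α0 → trans (+-cancelʳ-≡ (β a) (α (a ⊙1)) (α a) (trans (ω₁-in-row a) (sym (ω₁-in-column a)))) αa≡α0)

    β-constant : ∀ a → β a ≡ β zero
    β-constant a = +-cancelˡ-≡ (α zero) (β a) (β zero)
      (trans (cong (_+ β a) (sym (α-constant a))) (trans (ω₁-in-column a) (sym (ω₁-in-column zero))))

    k*β≡k' : k * β zero ≡ k'
    k*β≡k' = trans (sym (Σ-const k (β zero)))
                   (trans (Σ-cong k (λ a → trans (sym (β-constant a)) (β≡ε a))) ω₂-in-column)

    ω₁-below-diagonal : 1 ≤ k' → 1 ≤ β zero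
    ω₁-below-diagonal 1≤k' with β zero in β0≡
    ... | suc _ = s≤s z≤n
    ... | zero  = ⊥-elim (<⇒≢ 1≤k' (sym (trans (sym k*β≡k') (trans (cong (k *_) β0≡) (*-zeroʳ k)))))

  -- The cell (1 ⊙ 1, 1) of U_k contains k+1 only once, but each part of a
  -- join would have to contribute a copy of it.
  non-separable : NonSeparable (k + 2) k Uₖ
  non-separable (k₁ , k₂ , 1≤k₁ , 1≤k₂ , _ , A , B , A-latin , B-latin , U≡A⊔B) = <⇒≱ (s≤s (s≤s z≤n)) 2≤1
    where
    open Join {L = Uₖ} {A} {B} U≡A⊔B
    module SA = Subsquare k₁ A A-latin left-⊑
    module SB = Subsquare k₂ B B-latin right-⊑

    once : mult ω₁ (Uₖ (E (zero ⊙1)) (E zero)) ≡ 1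
    once = trans (cong (mult ω₁) (col-cell (zero ⊙1) zero)) (Col.ω₁-at-q zero)

    2≤1 : 2 ≤ 1
    2≤1 = subst (2 ≤_) (trans (sym (mult-join (E (zero ⊙1)) (E zero) ω₁)) once)
                (+-mono-≤ (SA.ω₁-below-diagonal 1≤k₁) (SB.ω₁-below-diagonal 1≤k₂))

mainTheorem9 : (k : ℕ) → 3 ≤ k →
    (_∘_ _\\_ _//_ : Op₂ (Fin k)) →
    IsQuasigroup _≡_ _∘_ _\\_ _//_ →
    (∀ a → a ∘ a ≡ a) →
    IsKLatin (k + 2) k (U k _∘_) × NonSeparable (k + 2) k (U k _∘_)
mainTheorem9 (suc m) (s≤s (s≤s _)) _∘_ _\\_ _//_ isQuasigroup idem = latin , non-separable
  where open Construction m (s≤s z≤n) _∘_ _\\_ _//_ isQuasigroup idem
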